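{- Let $t,k$ be nonnegative integers. Then: (a) $\displaystyle\sum_{j=0}^{t}\binom{t}{j}\binom{k+l+j}{l}\equiv 0\pmod 2$ for $l=0,1,\dots,t-1$; (b) $\displaystyle\sum_{j=0}^{t-1}\binom{t}{j}\binom{k+l+j}{l}\equiv\binom{k+l+t}{l}\pmod 2$ for $l=0,1,\dots,t-1$; (c) $\displaystyle\sum_{j=0}^{t-1}\binom{t}{j}\binom{k+l+j}{l}\equiv\binom{k+l+t}{l}+\binom{k+l}{l-t}\pmod 2$ for all $l=0,1,2,\dots$.
   Context: Convention: $\binom{a}{b}=0$ whenever $b<0$ (and whenever $b>a\ge0$). -}

module Defs where

open import Data.Nat using (ℕ; zero; suc; _+_; _≤ᵇ_; _∸_)
open import Data.Nat.Combinatorics using (_C_)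
open import Data.Bool using (if_then_else_)

sumBelow : ℕ → (ℕ → ℕ) → ℕ
sumBelow zero    f = 0
sumBelow (suc n) f = sumBelow n f + f n

-- binomial (a choose (b - c)) with the convention that it is 0 when b - c < 0,
-- i.e. when b < c (the lower index is the integer b - c).
chooseSub : ℕ → ℕ → ℕ → ℕ
chooseSub a b c = if c ≤ᵇ b then a C (b ∸ c) else 0

-- Write n C[ l ∸ t ] for the binomial coefficient (n choose l − t), which vanishes when l < t.
-- Pascal's rule for ((t+1) choose j) gives
--   F(t+1, n) = F(t, n) + F(t, n+1),   where F(t, n) = Σ_{j ≤ t} (t choose j) ((n+j) choose l),
-- while Pascal's rule in the upper index of n C[ l ∸ t ] gives
--   (n+1) C[ l ∸ t ] = n C[ l ∸ t ] + n C[ l ∸ (t+1) ].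
-- So modulo 2, F(t, n) ≡ n C[ l ∸ t ] by induction on t, the doubled term cancelling.
-- With n = k + l this is (a) (as l < t) and, after moving the term j = t across, (c).
module Submission where

open import Defs
open import Data.Nat using (ℕ; zero; suc; _+_; _*_; _<_; _%_; s≤s)
open import Data.Nat.Properties
  using (+-assoc; +-comm; +-identityʳ; *-comm; +-suc; *-identityˡ; *-distribʳ-+; ≤-refl; +-commutativeSemigroup)
open import Data.Nat.DivMod using (%-distribˡ-+; [m+kn]%n≡m%n)
open import Data.Nat.Combinatorics using (_C_; nCn≡1; nCk+nC[k+1]≡[n+1]C[k+1])
open import Data.Nat.Combinatorics.Specification using (k>n⇒nCk≡0)
open import Algebra.Properties.CommutativeSemigroup +-commutativeSemigroup using (interchange)
open import Data.Product using (_×_; _,_)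
open import Relation.Binary.PropositionalEquality
open ≡-Reasoning

_C[_∸_] : ℕ → ℕ → ℕ → ℕ
n C[ l ∸ zero ] = n C l
n C[ zero ∸ suc t ] = 0
n C[ suc l ∸ suc t ] = n C[ l ∸ t ]

C[∸]-pascal : ∀ n l t → suc n C[ l ∸ t ] ≡ n C[ l ∸ t ] + n C[ l ∸ suc t ]
C[∸]-pascal n zero zero = refl
C[∸]-pascal n (suc l) zero = trans (sym (nCk+nC[k+1]≡[n+1]C[k+1] n l)) (+-comm (n C l) (n C suc l))
C[∸]-pascal n zero (suc t) = refl
C[∸]-pascal n (suc l) (suc t) = C[∸]-pascal n l t

C[∸]-< : ∀ n {l t} → l < t → n C[ l ∸ t ] ≡ 0
C[∸]-< n {zero} {suc t} _ = refl
C[∸]-< n {suc l} {suc t} (s≤s l<t) = C[∸]-< n l<t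

chooseSub≡C[∸] : ∀ n l t → chooseSub n l t ≡ n C[ l ∸ t ]
chooseSub≡C[∸] n l zero = refl
chooseSub≡C[∸] n zero (suc t) = refl
chooseSub≡C[∸] n (suc l) (suc zero) = refl
chooseSub≡C[∸] n (suc zero) (suc (suc t)) = refl
chooseSub≡C[∸] n (suc (suc l)) (suc (suc t)) = chooseSub≡C[∸] n (suc l) (suc t)

sumBelow-cong : ∀ m {f g : ℕ → ℕ} → (∀ j → f j ≡ g j) → sumBelow m f ≡ sumBelow m g
sumBelow-cong zero f≡g = refl
sumBelow-cong (suc m) f≡g = cong₂ _+_ (sumBelow-cong m f≡g) (f≡g m)

sumBelow-binomial-pascal : ∀ m t (g : ℕ → ℕ) →
  sumBelow (suc m) (λ j → (suc t C j) * g j)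
    ≡ sumBelow (suc m) (λ j → (t C j) * g j) + sumBelow m (λ j → (t C j) * g (suc j))
sumBelow-binomial-pascal zero t g = sym (+-identityʳ _)
sumBelow-binomial-pascal (suc m) t g = begin
  sumBelow (suc m) (λ j → (suc t C j) * g j) + (suc t C suc m) * g (suc m)
    ≡⟨ cong₂ _+_ (sumBelow-binomial-pascal m t g) split-last ⟩
  (A + B) + ((t C suc m) * g (suc m) + (t C m) * g (suc m))
    ≡⟨ interchange A B _ _ ⟩
  (A + (t C suc m) * g (suc m)) + (B + (t C m) * g (suc m)) ∎
  where
  A = sumBelow (suc m) (λ j → (t C j) * g j)
  B = sumBelow m (λ j → (t C j) * g (suc j))
  split-last : (suc t C suc m) * g (suc m) ≡ (t C suc m) * g (suc m) + (t C m) * g (suc m)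
  split-last = begin
    (suc t C suc m) * g (suc m)             ≡⟨ cong (_* g (suc m)) (sym (nCk+nC[k+1]≡[n+1]C[k+1] t m)) ⟩
    (t C m + t C suc m) * g (suc m)         ≡⟨ cong (_* g (suc m)) (+-comm (t C m) (t C suc m)) ⟩
    (t C suc m + t C m) * g (suc m)         ≡⟨ *-distribʳ-+ (g (suc m)) (t C suc m) (t C m) ⟩
    (t C suc m) * g (suc m) + (t C m) * g (suc m) ∎

binomialSum : ℕ → ℕ → ℕ → ℕ
binomialSum t n l = sumBelow (suc t) (λ j → (t C j) * ((n + j) C l))

binomialSum-pascal : ∀ t n l → binomialSum (suc t) n l ≡ binomialSum t n l + binomialSum t (suc n) l
binomialSum-pascal t n l = begin
  binomialSum (suc t) n l
    ≡⟨ sumBelow-binomial-pascal (suc t) t g ⟩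
  (binomialSum t n l + (t C suc t) * g (suc t)) + sumBelow (suc t) (λ j → (t C j) * g (suc j))
    ≡⟨ cong₂ _+_ drop-vanishing-term
                 (sumBelow-cong (suc t) (λ j → cong (λ m → (t C j) * (m C l)) (+-suc n j))) ⟩
  binomialSum t n l + binomialSum t (suc n) l ∎
  where
  g : ℕ → ℕ
  g j = (n + j) C l
  drop-vanishing-term : binomialSum t n l + (t C suc t) * g (suc t) ≡ binomialSum t n l
  drop-vanishing-term =
    trans (cong (λ c → binomialSum t n l + c * g (suc t)) (k>n⇒nCk≡0 {t} {suc t} (s≤s ≤-refl)))
          (+-identityʳ _)

infix 4 _≡₂_
_≡₂_ : ℕ → ℕ → Set
a ≡₂ b = a % 2 ≡ b % 2

+-cong-≡₂ : ∀ {a a′ b b′} → a ≡₂ a′ → b ≡₂ b′ → a + b ≡₂ a′ + b′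
+-cong-≡₂ {a} {a′} {b} {b′} a≡a′ b≡b′ = begin
  (a + b) % 2           ≡⟨ %-distribˡ-+ a b 2 ⟩
  (a % 2 + b % 2) % 2   ≡⟨ cong₂ (λ x y → (x + y) % 2) a≡a′ b≡b′ ⟩
  (a′ % 2 + b′ % 2) % 2 ≡⟨ %-distribˡ-+ a′ b′ 2 ⟨
  (a′ + b′) % 2         ∎

x+x+y≡₂y : ∀ x y → x + (x + y) ≡₂ y
x+x+y≡₂y x y = begin
  (x + (x + y)) % 2 ≡⟨ cong (_% 2) (+-assoc x x y) ⟨
  (x + x + y) % 2   ≡⟨ cong (_% 2) (+-comm (x + x) y) ⟩
  (y + (x + x)) % 2 ≡⟨ cong (λ z → (y + z) % 2) x+x≡x*2 ⟩
  (y + x * 2) % 2   ≡⟨ [m+kn]%n≡m%n y x 2 ⟩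
  y % 2             ∎
  where
  x+x≡x*2 : x + x ≡ x * 2
  x+x≡x*2 = trans (cong (x +_) (sym (+-identityʳ x))) (*-comm 2 x)

m+n≡₂o⇒m≡₂n+o : ∀ m n o → m + n ≡₂ o → m ≡₂ n + o
m+n≡₂o⇒m≡₂n+o m n o m+n≡₂o = begin
  m % 2             ≡⟨ x+x+y≡₂y n m ⟨
  (n + (n + m)) % 2 ≡⟨ cong (λ z → (n + z) % 2) (+-comm n m) ⟩
  (n + (m + n)) % 2 ≡⟨ +-cong-≡₂ {n} {n} {m + n} {o} refl m+n≡₂o ⟩
  (n + o) % 2       ∎

binomialSum≡₂C[∸] : ∀ t n l → binomialSum t n l ≡₂ n C[ l ∸ t ]
binomialSum≡₂C[∸] zero n l = cong (_% 2) (trans (+-identityʳ _) (cong (_C l) (+-identityʳ n)))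
binomialSum≡₂C[∸] (suc t) n l = begin
  binomialSum (suc t) n l % 2
    ≡⟨ cong (_% 2) (binomialSum-pascal t n l) ⟩
  (binomialSum t n l + binomialSum t (suc n) l) % 2
    ≡⟨ +-cong-≡₂ {binomialSum t n l} {n C[ l ∸ t ]} {binomialSum t (suc n) l} {suc n C[ l ∸ t ]}
                  (binomialSum≡₂C[∸] t n l) (binomialSum≡₂C[∸] t (suc n) l) ⟩
  (n C[ l ∸ t ] + suc n C[ l ∸ t ]) % 2
    ≡⟨ cong (λ z → (n C[ l ∸ t ] + z) % 2) (C[∸]-pascal n l t) ⟩
  (n C[ l ∸ t ] + (n C[ l ∸ t ] + n C[ l ∸ suc t ])) % 2
    ≡⟨ x+x+y≡₂y (n C[ l ∸ t ]) (n C[ l ∸ suc t ]) ⟩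
  n C[ l ∸ suc t ] % 2 ∎

module _ (t k l : ℕ) where
  private
    summand : ℕ → ℕ
    summand j = (t C j) * ((k + l + j) C l)

    S : ℕ
    S = sumBelow t summand

    last : ℕ
    last = (k + l + t) C l

  full-sum≡₂C[∸] : sumBelow (t + 1) summand ≡₂ (k + l) C[ l ∸ t ]
  full-sum≡₂C[∸] = subst (λ m → sumBelow m summand ≡₂ (k + l) C[ l ∸ t ]) (+-comm 1 t)
                         (binomialSum≡₂C[∸] t (k + l) l)

  partial-sum≡₂C[∸] : S ≡₂ last + (k + l) C[ l ∸ t ]
  partial-sum≡₂C[∸] = m+n≡₂o⇒m≡₂n+o S last ((k + l) C[ l ∸ t ])
    (trans (cong (λ z → (S + z) % 2) (sym last-summand)) (binomialSum≡₂C[∸] t (k + l) l))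
    where
    last-summand : summand t ≡ last
    last-summand = trans (cong (_* last) (nCn≡1 t)) (*-identityˡ last)

  partial-sum≡₂chooseSub : S ≡₂ last + chooseSub (k + l) l t
  partial-sum≡₂chooseSub =
    subst (λ c → S ≡₂ last + c) (sym (chooseSub≡C[∸] (k + l) l t)) partial-sum≡₂C[∸]

  module _ (l<t : l < t) where
    full-sum≡₂0 : sumBelow (t + 1) summand % 2 ≡ 0
    full-sum≡₂0 = trans full-sum≡₂C[∸] (cong (_% 2) (C[∸]-< (k + l) l<t))

    partial-sum≡₂last : S ≡₂ last
    partial-sum≡₂last = trans partial-sum≡₂C[∸]
      (cong (_% 2) (trans (cong (last +_) (C[∸]-< (k + l) l<t)) (+-identityʳ last)))

corollary1 : (t k : ℕ) →
    ((l : ℕ) → l < t →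
      sumBelow (t + 1) (λ j → (t C j) * ((k + l + j) C l)) % 2 ≡ 0)
  × ((l : ℕ) → l < t →
      sumBelow t (λ j → (t C j) * ((k + l + j) C l)) % 2 ≡ ((k + l + t) C l) % 2)
  × ((l : ℕ) →
      sumBelow t (λ j → (t C j) * ((k + l + j) C l)) % 2
        ≡ (((k + l + t) C l) + chooseSub (k + l) l t) % 2)
corollary1 t k = full-sum≡₂0 t k , partial-sum≡₂last t k , partial-sum≡₂chooseSub t k
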